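{- Let $H=(V,E)$ be a hypergraph such that the digraph $D_3(H)$ has a non-trivial spanning arborescence. Then $H$ is eulerian.
   Context: A hypergraph $H=(V,E)$ has a nonempty finite vertex set $V$ and a finite set $E$ of edges, each associated with a subset of $V$ (parallel edges allowed); hypergraphs are assumed to have no empty edges. $D_3(H)$ is the digraph with vertex set $E$ and arc set $\{(e,f): e,f\in E,\ |f\setminus e|=1,\ |e\cap f|\ge 3\}$. An arborescence is a digraph whose underlying undirected graph is a tree and whose arcs are all directed towards a root; it is non-trivial if it has at least two vertices. A walk is $v_0e_1v_1\dots e_kv_k$ with $v_{i-1}\ne v_i$, $v_{i-1},v_i\in e_i$; closed if $k\ge2$ and $v_0=v_k$; a strict trail if $e_1,\dots,e_k$ are pairwise distinct. An Euler tour is a closed strict trail traversing every edge of $H$; $H$ is eulerian if it admits one. -}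

module Defs where

open import Data.Nat using (ℕ; suc; _<_; _≤_)
open import Data.Fin using (Fin; zero; suc; inject₁; fromℕ)
open import Data.Fin.Subset using (Subset; _∈_; _∩_; _─_; ∣_∣; Nonempty)
open import Data.Product using (Σ; ∃; _×_)
open import Function using (Injective; Surjective)
open import Relation.Binary.PropositionalEquality using (_≡_; _≢_)

-- Parallel edges are allowed, since distinct indices may carry the same subset.
record Hypergraph : Set where
  field
    n         : ℕ
    m         : ℕ
    V-nonempty : 0 < n
    edge      : Fin m → Subset n
    edge-nonempty : ∀ e → Nonempty (edge e)
open Hypergraph public

D₃-arc : (H : Hypergraph) → Fin (m H) → Fin (m H) → Set
D₃-arc H e f = (∣ edge H f ─ edge H e ∣ ≡ 1) × (3 ≤ ∣ edge H e ∩ edge H f ∣)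

iter : ∀ {A : Set} → (A → A) → ℕ → A → A
iter f ℕ.zero x = x
iter f (suc k) x = f (iter f k x)

-- A spanning arborescence of a digraph on vertex set Fin k with arc relation
-- Arc: a root r and, for every non-root vertex v, a unique outgoing tree arc
-- (v , parent v) which is an arc of the digraph; following parent arcs from
-- any vertex reaches the root (so the tree arcs form a spanning tree with all
-- arcs directed towards r).
record SpanningArborescence (k : ℕ) (Arc : Fin k → Fin k → Set) : Set where
  field
    root   : Fin k
    parent : Fin k → Fin k
    arc    : ∀ v → v ≢ root → Arc v (parent v)
    reaches-root : ∀ v → ∃ λ j → iter parent j v ≡ root

HasNontrivialSpanningArborescence : (k : ℕ) → (Fin k → Fin k → Set) → Set
HasNontrivialSpanningArborescence k Arc = (2 ≤ k) × SpanningArborescence k Arc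

-- An Euler tour: a closed walk v₀ e₁ v₁ … e_k v_k (k ≥ 2, v₀ = v_k,
-- v_{i-1} ≠ v_i, v_{i-1}, v_i ∈ e_i) whose edges are pairwise distinct
-- (strict trail) and which traverses every edge.
-- Here vs i = v_i (i = 0..k) and es i = e_{i+1} (i = 0..k-1).
record EulerTour (H : Hypergraph) : Set where
  field
    len    : ℕ
    vs     : Fin (suc len) → Fin (n H)
    es     : Fin len → Fin (m H)
    len≥2  : 2 ≤ len
    step-≢ : ∀ i → vs (inject₁ i) ≢ vs (suc i)
    step-∈ˡ : ∀ i → vs (inject₁ i) ∈ edge H (es i)
    step-∈ʳ : ∀ i → vs (suc i) ∈ edge H (es i)
    closed : vs zero ≡ vs (fromℕ len)
    strict : Injective _≡_ _≡_ es
    covers : ∀ e → ∃ λ i → es i ≡ e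

Eulerian : Hypergraph → Set
Eulerian H = EulerTour H

-- Grow a closed strict trail one edge at a time.  Start with the two-edge
-- trail a →c→ b →r→ a through the root r and a child c, where a, b are
-- distinct vertices of c ∩ r.  If an edge is still missing, follow the
-- arborescence from it towards r until the first arc (e, f) with f on the
-- trail and e not.  Since |f ∖ e| = 1, of the two ends u, v of the step of
-- the trail through f one lies in e, and since |e ∩ f| ≥ 3 there is a third
-- vertex z of e ∩ f; replacing u →f→ v by u →e→ z →f→ v (or u →f→ z →e→ v)
-- adds e to the trail.  The trail cannot outgrow the edge set.
module Submission where

open import Defs
open import Data.Nat using (zero; suc; _≤_; _<_; s≤s; z≤n; _+_)
open import Data.Nat.Properties
  using (≤-trans; ≤-reflexive; ≤-<-trans; <-irrefl; n≤1+n; +-suc; +-comm; m≤m+n; ≤-pred; _≤?_; ≰⇒>)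
open import Data.Fin using (Fin; zero; suc; inject₁; fromℕ; punchIn)
open import Data.Fin.Properties as Fin using (pigeonhole; punchInᵢ≢i; all?; ¬∀⟶∃¬) renaming (<-irrefl to <-irreflᶠ)
open import Data.Fin.Subset using (Subset; _∈_; _∉_; _∩_; _─_; _-_; ∣_∣; ⁅_⁆; inside; outside; Nonempty)
open import Data.Fin.Subset.Properties
  using (x∈p∩q⁻; x∈p∧x∉q⇒x∈p─q; x∈p∧x≢y⇒x∈p-y; x∈p⇒∣p-x∣<∣p∣; p─q⊆p; x∉⁅y⁆⇒x≢y; ∣⁅x⁆∣≡1; _∈?_)
open import Data.Vec using (_∷_; []; here; there)
open import Data.List using (List; []; _∷_; map; length; lookup)
open import Data.List.Properties using (length-map)
import Data.List.Membership.Propositional as List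
open import Data.List.Membership.Propositional.Properties using (∈-lookup)
open import Data.List.Relation.Unary.Any using (here; there; index)
open import Data.List.Relation.Unary.Any.Properties using (lookup-index) renaming (map⁻ to Any-map⁻)
open import Data.List.Relation.Unary.All as All using ([]; _∷_)
open import Data.List.Relation.Unary.All.Properties using (¬Any⇒All¬) renaming (map⁻ to All-map⁻)
open import Data.List.Relation.Unary.AllPairs using ([]; _∷_)
open import Data.List.Relation.Unary.Unique.Propositional using (Unique)
open import Data.List.Relation.Binary.Permutation.Propositional using (_↭_; ↭-refl; ↭-prep; ↭-swap; ↭-trans; ↭-sym; ↭⇒↭ₛ)
open import Data.List.Relation.Binary.Permutation.Propositional.Properties using (∈-resp-↭; ↭-length)
open import Data.List.Relation.Binary.Permutation.Setoid.Properties using (Unique-resp-↭)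
open import Data.Product using (Σ; ∃; _×_; _,_; proj₁; proj₂)
open import Data.Sum using (_⊎_; inj₁; inj₂)
open import Function using (_∘_)
open import Relation.Nullary using (¬_; Dec; yes; no; contradiction)
open import Relation.Binary.PropositionalEquality using (_≡_; _≢_; refl; sym; trans; cong; subst; setoid; module ≡-Reasoning)

∣p∣≤∣p─q∣+∣q∣ : ∀ {n} (p q : Subset n) → ∣ p ∣ ≤ ∣ p ─ q ∣ + ∣ q ∣
∣p∣≤∣p─q∣+∣q∣ []           []           = z≤n
∣p∣≤∣p─q∣+∣q∣ (inside ∷ p)  (inside ∷ q)  = ≤-trans (s≤s (∣p∣≤∣p─q∣+∣q∣ p q)) (≤-reflexive (sym (+-suc _ _)))
∣p∣≤∣p─q∣+∣q∣ (inside ∷ p)  (outside ∷ q) = s≤s (∣p∣≤∣p─q∣+∣q∣ p q)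
∣p∣≤∣p─q∣+∣q∣ (outside ∷ p) (inside ∷ q)  = ≤-trans (∣p∣≤∣p─q∣+∣q∣ p q) (≤-trans (n≤1+n _) (≤-reflexive (sym (+-suc _ _))))
∣p∣≤∣p─q∣+∣q∣ (outside ∷ p) (outside ∷ q) = ∣p∣≤∣p─q∣+∣q∣ p q

∣p∣≤1+∣p-x∣ : ∀ {n} (p : Subset n) x → ∣ p ∣ ≤ suc ∣ p - x ∣
∣p∣≤1+∣p-x∣ p x = ≤-trans (∣p∣≤∣p─q∣+∣q∣ p ⁅ x ⁆)
  (≤-reflexive (trans (cong (∣ p - x ∣ +_) (∣⁅x⁆∣≡1 x)) (+-comm _ 1)))

x∈p─q⇒x∉q : ∀ {n} {x : Fin n} (p q : Subset n) → x ∈ p ─ q → x ∉ q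
x∈p─q⇒x∉q (_ ∷ p) (outside ∷ q) here        = λ ()
x∈p─q⇒x∉q (_ ∷ p) (_       ∷ q) (there x∈) = λ { (there x∈q) → x∈p─q⇒x∉q p q x∈ x∈q }

0<∣p∣⇒Nonempty : ∀ {n} (p : Subset n) → 0 < ∣ p ∣ → Nonempty p
0<∣p∣⇒Nonempty (inside ∷ p)  _ = zero , here
0<∣p∣⇒Nonempty (outside ∷ p) h with 0<∣p∣⇒Nonempty p h
... | x , x∈p = suc x , there x∈p

∃-∈-∉ : ∀ {n} (p : Subset n) (xs : List (Fin n)) → length xs < ∣ p ∣ →
        ∃ λ z → z ∈ p × ¬ z List.∈ xs
∃-∈-∉ p []       h = let z , z∈p = 0<∣p∣⇒Nonempty p h in z , z∈p , λ ()
∃-∈-∉ p (x ∷ xs) h with ∃-∈-∉ (p - x) xs (≤-pred (≤-trans h (∣p∣≤1+∣p-x∣ p x)))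
... | z , z∈p-x , z∉xs = z , p─q⊆p p ⁅ x ⁆ z∈p-x , λ
  { (here refl) → x∉⁅y⁆⇒x≢y (x∈p─q⇒x∉q p ⁅ x ⁆ z∈p-x) refl
  ; (there z∈xs) → z∉xs z∈xs }

x∈p∧y∈p∧x≢y⇒2≤∣p∣ : ∀ {n} {p : Subset n} {x y : Fin n} → x ∈ p → y ∈ p → x ≢ y → 2 ≤ ∣ p ∣
x∈p∧y∈p∧x≢y⇒2≤∣p∣ {p = p} {x} x∈p y∈p x≢y =
  ≤-<-trans (≤-<-trans z≤n (x∈p⇒∣p-x∣<∣p∣ {p = p - x} (x∈p∧x≢y⇒x∈p-y y∈p (x≢y ∘ sym))))
            (x∈p⇒∣p-x∣<∣p∣ x∈p)

∣q─p∣≡1⇒∈⊎∈ : ∀ {n} {p q : Subset n} {x y : Fin n} → ∣ q ─ p ∣ ≡ 1 →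
            x ∈ q → y ∈ q → x ≢ y → x ∈ p ⊎ y ∈ p
∣q─p∣≡1⇒∈⊎∈ {p = p} {x = x} {y} ∣q─p∣≡1 x∈q y∈q x≢y with x ∈? p | y ∈? p
... | yes x∈p | _       = inj₁ x∈p
... | no _    | yes y∈p = inj₂ y∈p
... | no x∉p  | no y∉p  with subst (2 ≤_) ∣q─p∣≡1 (x∈p∧y∈p∧x≢y⇒2≤∣p∣ (x∈p∧x∉q⇒x∈p─q x∈q x∉p) (x∈p∧x∉q⇒x∈p─q y∈q y∉p) x≢y)
...   | s≤s ()

module _ {A B : Set} (g : A → B) where

  Unique-map⇒lookup-injective : ∀ {xs : List A} → Unique (map g xs) →
    ∀ {i j} → g (lookup xs i) ≡ g (lookup xs j) → i ≡ j
  Unique-map⇒lookup-injective {x ∷ xs} _ {zero} {zero} _ = refl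
  Unique-map⇒lookup-injective {x ∷ xs} (x∉ ∷ _) {zero} {suc j} eq =
    contradiction eq (All.lookup (All-map⁻ x∉) (∈-lookup j))
  Unique-map⇒lookup-injective {x ∷ xs} (x∉ ∷ _) {suc i} {zero} eq =
    contradiction (sym eq) (All.lookup (All-map⁻ x∉) (∈-lookup i))
  Unique-map⇒lookup-injective {x ∷ xs} (_ ∷ u) {suc i} {suc j} eq =
    cong suc (Unique-map⇒lookup-injective u eq)

  ∈-map⇒∃-lookup : ∀ {xs : List A} {y} → y List.∈ map g xs → ∃ λ i → g (lookup xs i) ≡ y
  ∈-map⇒∃-lookup y∈ = let y∈′ = Any-map⁻ y∈ in index y∈′ , sym (lookup-index y∈′)

Unique-map⇒length≤ : ∀ {A : Set} {k} (g : A → Fin k) (xs : List A) → Unique (map g xs) → length xs ≤ k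
Unique-map⇒length≤ {k = k} g xs u with length xs ≤? k
... | yes ≤k = ≤k
... | no  ≰k with pigeonhole (≰⇒> ≰k) (g ∘ lookup xs)
...   | i , j , i<j , gᵢ≡gⱼ = contradiction i<j (<-irreflᶠ (Unique-map⇒lookup-injective g u gᵢ≡gⱼ))

iter-crossing : ∀ {A : Set} {P : A → Set} → (∀ a → Dec (P a)) → (f : A → A) → ∀ j {x} →
                ¬ P x → P (iter f j x) → ∃ λ c → ¬ P c × P (f c)
iter-crossing P? f zero    ¬Px Px = contradiction Px ¬Px
iter-crossing P? f (suc j) ¬Px Pfʲ⁺¹x with P? (iter f j _)
... | yes Pfʲx = iter-crossing P? f j ¬Px Pfʲx
... | no ¬Pfʲx = iter f j _ , ¬Pfʲx , Pfʲ⁺¹x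

∃-≢ : ∀ {k} → 2 ≤ k → (r : Fin k) → ∃ λ i → i ≢ r
∃-≢ {suc zero}    (s≤s ()) _
∃-≢ {suc (suc _)} _        r = punchIn r zero , punchInᵢ≢i r zero

module Trails (H : Hypergraph) where

  V E : Set
  V = Fin (n H)
  E = Fin (m H)

  Link : E → V → V → Set
  Link e u v = u ≢ v × u ∈ edge H e × v ∈ edge H e

  data Walk : V → List (E × V) → V → Set where
    []  : ∀ {u} → Walk u [] u
    _∷_ : ∀ {u e v hs w} → Link e u v → Walk v hs w → Walk u ((e , v) ∷ hs) w

  edges : List (E × V) → List E
  edges = map proj₁

  vertexAt : V → (hs : List (E × V)) → Fin (suc (length hs)) → V
  vertexAt u hs       zero    = u
  vertexAt u (h ∷ hs) (suc i) = vertexAt (proj₂ h) hs i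

  lookup-Link : ∀ {u hs w} → Walk u hs w → ∀ i →
    Link (proj₁ (lookup hs i)) (vertexAt u hs (inject₁ i)) (vertexAt u hs (suc i))
  lookup-Link (link ∷ _) zero    = link
  lookup-Link (_    ∷ p) (suc i) = lookup-Link p i

  vertexAt-last : ∀ {u hs w} → Walk u hs w → vertexAt u hs (fromℕ (length hs)) ≡ w
  vertexAt-last []      = refl
  vertexAt-last (_ ∷ p) = vertexAt-last p

  edges↭⇒length-suc : ∀ {hs hs′ c} → edges hs′ ↭ c ∷ edges hs → length hs′ ≡ suc (length hs)
  edges↭⇒length-suc {hs} {hs′} {c} edges↭ = begin
    length hs′               ≡⟨ sym (length-map proj₁ hs′) ⟩
    length (edges hs′)       ≡⟨ ↭-length edges↭ ⟩
    suc (length (edges hs))  ≡⟨ cong suc (length-map proj₁ hs) ⟩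
    suc (length hs)          ∎
    where open ≡-Reasoning

  record ClosedTrail : Set where
    field
      start  : V
      hops   : List (E × V)
      walk   : Walk start hops start
      strict : Unique (edges hops)
      long   : 2 ≤ length hops

  open ClosedTrail public

  ClosedTrail⇒EulerTour : (t : ClosedTrail) → (∀ e → e List.∈ edges (hops t)) → EulerTour H
  ClosedTrail⇒EulerTour t covers = record
    { len     = length (hops t)
    ; vs      = vertexAt (start t) (hops t)
    ; es      = λ i → proj₁ (lookup (hops t) i)
    ; len≥2   = long t
    ; step-≢  = λ i → proj₁ (lookup-Link (walk t) i)
    ; step-∈ˡ = λ i → proj₁ (proj₂ (lookup-Link (walk t) i))
    ; step-∈ʳ = λ i → proj₂ (proj₂ (lookup-Link (walk t) i))
    ; closed  = sym (vertexAt-last (walk t))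
    ; strict  = Unique-map⇒lookup-injective proj₁ (strict t)
    ; covers  = λ e → ∈-map⇒∃-lookup proj₁ (covers e)
    }

  detour-hop : ∀ {e f u v hs w} → D₃-arc H e f → Link f u v → Walk v hs w →
               ∃ λ hs′ → Walk u hs′ w × edges hs′ ↭ e ∷ f ∷ edges hs
  detour-hop {e} {f} {u} {v} {hs} {w} (∣f─e∣≡1 , 3≤∣e∩f∣) (u≢v , u∈f , v∈f) p =
    reroute (∣q─p∣≡1⇒∈⊎∈ ∣f─e∣≡1 u∈f v∈f u≢v)
    where
    third : ∃ λ z → z ∈ edge H e ∩ edge H f × ¬ z List.∈ u ∷ v ∷ []
    third = ∃-∈-∉ (edge H e ∩ edge H f) (u ∷ v ∷ []) 3≤∣e∩f∣
    z : V
    z = proj₁ third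
    z∈e×z∈f : z ∈ edge H e × z ∈ edge H f
    z∈e×z∈f = x∈p∩q⁻ (edge H e) (edge H f) (proj₁ (proj₂ third))
    u≢z : u ≢ z
    u≢z u≡z = proj₂ (proj₂ third) (here (sym u≡z))
    z≢v : z ≢ v
    z≢v z≡v = proj₂ (proj₂ third) (there (here z≡v))
    reroute : u ∈ edge H e ⊎ v ∈ edge H e → ∃ λ hs′ → Walk u hs′ w × edges hs′ ↭ e ∷ f ∷ edges hs
    reroute (inj₁ u∈e) = _ , (u≢z , u∈e , proj₁ z∈e×z∈f) ∷ (z≢v , proj₂ z∈e×z∈f , v∈f) ∷ p , ↭-refl
    reroute (inj₂ v∈e) = _ , (u≢z , u∈f , proj₂ z∈e×z∈f) ∷ (z≢v , proj₁ z∈e×z∈f , v∈e) ∷ p , ↭-swap f e ↭-refl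

  detour : ∀ {e f u hs w} → D₃-arc H e f → Walk u hs w → f List.∈ edges hs →
           ∃ λ hs′ → Walk u hs′ w × edges hs′ ↭ e ∷ edges hs
  detour arc (link ∷ p) (here refl) = detour-hop arc link p
  detour arc (link ∷ p) (there f∈)  with detour arc p f∈
  ... | _ , p′ , edges↭ = _ , link ∷ p′ , ↭-trans (↭-prep _ edges↭) (↭-swap _ _ ↭-refl)

module Arborescence (H : Hypergraph) (A : SpanningArborescence (m H) (D₃-arc H)) where
  open Trails H
  open SpanningArborescence A
  open import Data.List.Membership.DecPropositional (Fin._≟_ {m H}) using () renaming (_∈?_ to _∈ₗ?_)

  Rooted : ClosedTrail → Set
  Rooted t = root List.∈ edges (hops t)

  seed : 2 ≤ m H → Σ ClosedTrail Rooted
  seed 2≤m with ∃-≢ 2≤m root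
  ... | e , e≢root with iter-crossing (Fin._≟ root) parent (proj₁ (reaches-root e)) e≢root (proj₂ (reaches-root e))
  ... | c , c≢root , parent-c≡root with subst (D₃-arc H c) parent-c≡root (arc c c≢root)
  ... | _ , 3≤∣c∩r∣ with ∃-∈-∉ (edge H c ∩ edge H root) [] (≤-trans (s≤s z≤n) 3≤∣c∩r∣)
  ... | a , a∈c∩r , _ with ∃-∈-∉ (edge H c ∩ edge H root) (a ∷ []) (≤-trans (s≤s (s≤s z≤n)) 3≤∣c∩r∣)
  ... | b , b∈c∩r , b∉a = trail , there (here refl)
    where
    a∈ : a ∈ edge H c × a ∈ edge H root
    a∈ = x∈p∩q⁻ (edge H c) (edge H root) a∈c∩r
    b∈ : b ∈ edge H c × b ∈ edge H root
    b∈ = x∈p∩q⁻ (edge H c) (edge H root) b∈c∩r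
    a≢b : a ≢ b
    a≢b a≡b = b∉a (here (sym a≡b))
    trail : ClosedTrail
    trail = record
      { start  = a
      ; hops   = (c , b) ∷ (root , a) ∷ []
      ; walk   = (a≢b , proj₁ a∈ , proj₁ b∈) ∷ (a≢b ∘ sym , proj₂ b∈ , proj₂ a∈) ∷ []
      ; strict = (c≢root ∷ []) ∷ [] ∷ []
      ; long   = s≤s (s≤s z≤n)
      }

  extend : (t : ClosedTrail) → Rooted t → ∀ {e} → ¬ e List.∈ edges (hops t) →
           Σ ClosedTrail λ t′ → Rooted t′ × length (hops t′) ≡ suc (length (hops t))
  extend t root∈ {e} e∉
    with iter-crossing (_∈ₗ? edges (hops t)) parent (proj₁ (reaches-root e)) e∉
           (subst (List._∈ edges (hops t)) (sym (proj₂ (reaches-root e))) root∈)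
  ... | c , c∉ , parent-c∈ with detour (arc c (λ { refl → c∉ root∈ })) (walk t) parent-c∈
  ... | hs′ , p′ , edges↭ = trail , ∈-resp-↭ (↭-sym edges↭) (there root∈) , edges↭⇒length-suc edges↭
    where
    trail : ClosedTrail
    trail = record
      { start  = start t
      ; hops   = hs′
      ; walk   = p′
      ; strict = Unique-resp-↭ (setoid E) (↭⇒↭ₛ (↭-sym edges↭)) (¬Any⇒All¬ _ c∉ ∷ strict t)
      ; long   = subst (2 ≤_) (sym (edges↭⇒length-suc edges↭)) (≤-trans (long t) (n≤1+n _))
      }

  cover : ∀ k (t : ClosedTrail) → Rooted t → m H ≤ k + length (hops t) → EulerTour H
  cover k t root∈ m≤ with all? (_∈ₗ? edges (hops t))
  ... | yes covers = ClosedTrail⇒EulerTour t covers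
  ... | no ¬covers with ¬∀⟶∃¬ (m H) _ (_∈ₗ? edges (hops t)) ¬covers | k
  ...   | e , e∉ | zero = contradiction
          (≤-trans (Unique-map⇒length≤ proj₁ ((e , start t) ∷ hops t) (¬Any⇒All¬ _ e∉ ∷ strict t)) m≤)
          (<-irrefl refl)
  ...   | e , e∉ | suc k′ with extend t root∈ e∉
  ...     | t′ , root∈′ , length≡ =
          cover k′ t′ root∈′ (≤-trans m≤ (≤-reflexive (trans (sym (+-suc k′ _)) (cong (k′ +_) (sym length≡)))))

mainTheorem5 : (H : Hypergraph) →
    HasNontrivialSpanningArborescence (m H) (D₃-arc H) → Eulerian H
mainTheorem5 H (2≤m , A) =
  let trail , root∈ = seed 2≤m in cover (m H) trail root∈ (m≤m+n (m H) _)
  where open Arborescence H A
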